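{- Let $m,n$ be positive integers, let $u$ and $v$ be adjacent vertices of $K_{n,n}$, and let $x$ and $y$ be two different vertices of the larger partite set (of size $m+1$) of $K_{m+1,m}$. Then the graph $G$ obtained from the disjoint union $K_{n,n}\cup K_{m+1,m}$ by adding the edges $ux$ and $vy$ is factor-critical and equimatchable.
   Context: $G$ is factor-critical if $G-w$ has a perfect matching for every vertex $w$; equimatchable if every maximal matching is maximum. -}

module Defs where

open import Data.Nat using (ℕ; suc; _≤_)
open import Data.Fin using (Fin)
open import Data.Product using (_×_; _,_; proj₁; proj₂; ∃-syntax)
open import Data.Sum using (_⊎_; inj₁; inj₂)
open import Data.List using (List; []; _∷_; length)
open import Data.List.Relation.Unary.All using (All)
open import Data.List.Relation.Unary.Unique.Propositional using (Unique)
open import Data.List.Membership.Propositional using (_∈_; _∉_)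
open import Relation.Binary.PropositionalEquality using (_≡_; _≢_)
open import Relation.Nullary using (¬_)
open import Data.Empty using (⊥)

record Graph : Set₁ where
  field
    V   : Set
    Adj : V → V → Set
open Graph public

EdgeList : Graph → Set
EdgeList G = List (V G × V G)

ends : {G : Graph} → EdgeList G → List (V G)
ends []             = []
ends {G} ((a , b) ∷ M)  = a ∷ b ∷ ends {G} M

IsMatching : (G : Graph) → EdgeList G → Set
IsMatching G M = All (λ e → Adj G (proj₁ e) (proj₂ e)) M × Unique (ends {G} M)

IsMaximal : (G : Graph) → EdgeList G → Set
IsMaximal G M = IsMatching G M ×
  (∀ a b → Adj G a b → a ∉ ends {G} M → b ∉ ends {G} M → ⊥)

IsMaximum : (G : Graph) → EdgeList G → Set
IsMaximum G M = IsMatching G M ×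
  (∀ M' → IsMatching G M' → length M' ≤ length M)

Equimatchable : Graph → Set
Equimatchable G = ∀ M → IsMaximal G M → IsMaximum G M

FactorCritical : Graph → Set
FactorCritical G = ∀ (w : V G) → ∃[ M ] (IsMatching G M × w ∉ ends {G} M ×
  (∀ z → z ≢ w → z ∈ ends {G} M))

KV : ℕ → ℕ → Set
KV p q = Fin p ⊎ Fin q

data KAdj {p q : ℕ} : KV p q → KV p q → Set where
  lr : ∀ i j → KAdj (inj₁ i) (inj₂ j)
  rl : ∀ i j → KAdj (inj₂ j) (inj₁ i)

K : ℕ → ℕ → Graph
K p q = record { V = KV p q ; Adj = KAdj }

-- The graph G of the statement: disjoint union K_{n,n} ∪ K_{m+1,m}
-- (K_{n,n} on the left, K_{m+1,m} on the right, the larger part of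
-- K_{m+1,m} being its  inj₁  side) plus the edges ux and vy.

GV : ℕ → ℕ → Set
GV n m = KV n n ⊎ KV (suc m) m

data GAdj (n m : ℕ) (u v : KV n n) (x y : Fin (suc m)) :
          GV n m → GV n m → Set where
  left  : ∀ {a b} → KAdj a b → GAdj n m u v x y (inj₁ a) (inj₁ b)
  right : ∀ {a b} → KAdj a b → GAdj n m u v x y (inj₂ a) (inj₂ b)
  ux    : GAdj n m u v x y (inj₁ u) (inj₂ (inj₁ x))
  xu    : GAdj n m u v x y (inj₂ (inj₁ x)) (inj₁ u)
  vy    : GAdj n m u v x y (inj₁ v) (inj₂ (inj₁ y))
  yv    : GAdj n m u v x y (inj₂ (inj₁ y)) (inj₁ v)

Gmn : (n m : ℕ) → KV n n → KV n n → Fin (suc m) → Fin (suc m) → Graph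
Gmn n m u v x y = record { V = GV n m ; Adj = GAdj n m u v x y }

module Submission where

-- G is the disjoint union of K_{n,n} (sides A, B) and K_{m+1,m} (sides X of
-- size m+1 and Z of size m) plus the edges ux and vy; it has 2(n+m)+1 vertices.
--
-- Factor-critical: for each vertex w we list n+m edges covering every vertex
-- except w, built from "diagonal" matchings of complete bipartite blocks and
-- one or both of ux, vy.  A pigeonhole argument on a listing of the vertices
-- then shows that these edges form a matching missing w, so no disjointness
-- bookkeeping is needed.
--
-- Equimatchable: a matching covers 2|M| of the 2(n+m)+1 vertices, so
-- |M| ≤ n+m.  A maximal matching covers a whole side of K_{n,n}, and all of X
-- or all of Z.  Such a side with Z, or such a side without its endpoint of
-- ux/vy with X, is an independent set of n+m covered vertices; as every edge
-- covers at most one of them, the maximal matching has n+m edges.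

open import Data.Nat using (ℕ; suc; _+_; _≤_; z≤n; s≤s; s≤s⁻¹; _≤?_)
open import Data.Nat.Properties using (≤-trans; ≤-reflexive; <-irrefl; +-suc; +-mono-≤; ≰⇒>)
open import Data.Fin using (Fin; punchIn; punchOut)
open import Data.Fin.Properties using (_≟_; all?; ¬∀⟶∃¬; punchIn-punchOut; punchIn-injective; punchInᵢ≢i)
open import Data.Product using (_×_; _,_; proj₁; proj₂; ∃-syntax)
import Data.Product as Product
open import Data.Sum using (_⊎_; inj₁; inj₂)
open import Data.Bool using (Bool; false; true)
import Data.Sum as Sum
open import Data.Sum.Properties using (inj₁-injective; inj₂-injective; ≡-dec)
open import Data.Nat.Tactic.RingSolver using (solve-∀)
open import Data.List using (List; []; _∷_; length; map; _++_; allFin)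
open import Data.List.Properties using (length-removeAt′; length-++; length-map; length-tabulate)
open import Data.List.Relation.Unary.All as All using (All; []; _∷_)
open import Data.List.Relation.Unary.All.Properties using (─⁺) renaming (map⁺ to All-map⁺; ++⁺ to All-++⁺)
open import Data.List.Relation.Unary.Any using (here; there; index)
open import Data.List.Relation.Unary.AllPairs using ([]; _∷_)
open import Data.List.Relation.Unary.Unique.Propositional using (Unique)
open import Data.List.Relation.Unary.Unique.Propositional.Properties using (allFin⁺) renaming (map⁺ to Unique-map⁺; ++⁺ to Unique-++⁺)
open import Data.List.Membership.Propositional using (_∈_; _∉_; _─_)
open import Data.List.Membership.Propositional.Properties using (∈-allFin; ∈-map⁺; ∈-map⁻; ∈-++⁺ˡ; ∈-++⁺ʳ)
import Data.List.Membership.DecPropositional as DecMembership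
open import Data.List.Relation.Binary.Subset.Propositional using (_⊆_)
open import Relation.Binary.Definitions using (DecidableEquality)
open import Relation.Binary.PropositionalEquality using (_≡_; _≢_; refl; sym; trans; cong; subst; subst₂; cong₂)
open import Relation.Nullary using (¬_; yes; no)
open import Data.Empty using (⊥; ⊥-elim)
open import Function using (_∘_)
open import Defs

module _ {T : Set} where

  ∈-─⁺ : ∀ {x z : T} {xs} (p : x ∈ xs) → z ∈ xs → z ≢ x → z ∈ xs ─ p
  ∈-─⁺ (here refl) (here z≡x) z≢x = ⊥-elim (z≢x z≡x)
  ∈-─⁺ (here refl) (there q)  _   = q
  ∈-─⁺ (there p)   (here z≡y) _   = here z≡y
  ∈-─⁺ (there p)   (there q)  z≢x = there (∈-─⁺ p q z≢x)

  ∈-─⁻ : ∀ {x z : T} {xs} (p : x ∈ xs) → z ∈ xs ─ p → z ∈ xs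
  ∈-─⁻ (here _)  q         = there q
  ∈-─⁻ (there p) (here e)  = here e
  ∈-─⁻ (there p) (there q) = there (∈-─⁻ p q)

  ∉-─ : ∀ {x z : T} {xs} → Unique xs → (p : x ∈ xs) → z ∈ xs ─ p → z ≢ x
  ∉-─ (y∉ys ∷ _)  (here refl) q           z≡y = All.lookup y∉ys q (sym z≡y)
  ∉-─ (y∉ys ∷ _)  (there p)   (here refl) z≡x = All.lookup y∉ys p z≡x
  ∉-─ (_ ∷ uniq)  (there p)   (there q)   = ∉-─ uniq p q

  unique-─ : ∀ {x : T} {xs} → Unique xs → (p : x ∈ xs) → Unique (xs ─ p)
  unique-─ (_ ∷ uniq)    (here _)  = uniq
  unique-─ (y∉ys ∷ uniq) (there p) =
    All.tabulate (λ q → All.lookup y∉ys (∈-─⁻ p q)) ∷ unique-─ uniq p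

  unique-length : ∀ {xs ys : List T} → Unique xs → xs ⊆ ys → length xs ≤ length ys
  unique-length {[]}     _             _   = z≤n
  unique-length {x ∷ xs} {ys} (x∉xs ∷ uniq) xs⊆ys =
    ≤-trans (s≤s (unique-length uniq rest⊆))
            (≤-reflexive (sym (length-removeAt′ ys (index x∈ys))))
    where
    x∈ys = xs⊆ys (here refl)
    rest⊆ : xs ⊆ ys ─ x∈ys
    rest⊆ z∈xs = ∈-─⁺ x∈ys (xs⊆ys (there z∈xs)) (λ z≡x → All.lookup x∉xs z∈xs (sym z≡x))

  unique-by-length : ∀ {E L : List T} → Unique E → E ⊆ L → L ⊆ E →
                     length L ≤ length E → Unique L
  unique-by-length {E} {[]}    _     _    _    _   = []
  unique-by-length {E} {z ∷ L} uniqE E⊆zL zL⊆E len =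
    All.tabulate z∉L ∷ unique-by-length (unique-─ uniqE z∈E) E─z⊆L L⊆E─z
      (s≤s⁻¹ (≤-trans len (≤-reflexive (length-removeAt′ E (index z∈E)))))
    where
    z∈E = zL⊆E (here refl)
    z∉L : ∀ {w} → w ∈ L → z ≢ w
    z∉L w∈L refl = <-irrefl refl (≤-trans len (unique-length uniqE E⊆L))
      where
      E⊆L : E ⊆ L
      E⊆L e∈E with E⊆zL e∈E
      ... | here refl = w∈L
      ... | there e∈L = e∈L
    E─z⊆L : E ─ z∈E ⊆ L
    E─z⊆L e∈E─z with E⊆zL (∈-─⁻ z∈E e∈E─z)
    ... | here e≡z  = ⊥-elim (∉-─ uniqE z∈E e∈E─z e≡z)
    ... | there e∈L = e∈L
    L⊆E─z : L ⊆ E ─ z∈E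
    L⊆E─z w∈L = ∈-─⁺ z∈E (zL⊆E (there w∈L)) (λ w≡z → z∉L w∈L (sym w≡z))

half : ∀ {a b} → a + a ≤ suc (b + b) → a ≤ b
half {a} {b} 2a≤2b+1 with a ≤? b
... | yes a≤b = a≤b
... | no  a≰b = ⊥-elim (<-irrefl refl (≤-trans 2b+2≤2a 2a≤2b+1))
  where
  2b+2≤2a : suc (suc (b + b)) ≤ a + a
  2b+2≤2a = subst (_≤ a + a) (cong suc (+-suc b b)) (+-mono-≤ (≰⇒> a≰b) (≰⇒> a≰b))

-- A property of Fin (suc k) that holds at p and at every punchIn p i
-- holds everywhere, since punchIn p enumerates all positions except p.
all-by-punchIn : ∀ {k} {P : Fin (suc k) → Set} p → P p → (∀ i → P (punchIn p i)) → ∀ t → P t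
all-by-punchIn {P = P} p Pp Ppunch t with p ≟ t
... | yes refl = Pp
... | no  p≢t  = subst P (punchIn-punchOut p≢t) (Ppunch (punchOut p≢t))

all-but : ∀ {k} {P : Fin (suc k) → Set} p → (∀ i → P (punchIn p i)) → ∀ t → t ≢ p → P t
all-but {P = P} p Ppunch = all-by-punchIn {P = λ t → t ≢ p → P t} p (λ p≢p → ⊥-elim (p≢p refl)) (λ i _ → Ppunch i)

record Listing (I : Set) (k : ℕ) : Set where
  field
    elems    : List I
    length≡  : length elems ≡ k
    unique   : Unique elems
    complete : ∀ a → a ∈ elems
open Listing

finListing : ∀ k → Listing (Fin k) k
finListing k = record
  { elems = allFin k ; length≡ = length-tabulate (λ i → i) ; unique = allFin⁺ k ; complete = ∈-allFin }

⊎-listing : ∀ {I J k l} → Listing I k → Listing J l → Listing (I ⊎ J) (k + l)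
⊎-listing LI LJ = record
  { elems    = map inj₁ (elems LI) ++ map inj₂ (elems LJ)
  ; length≡  = trans (length-++ (map inj₁ (elems LI)))
                     (cong₂ _+_ (trans (length-map inj₁ (elems LI)) (length≡ LI))
                                (trans (length-map inj₂ (elems LJ)) (length≡ LJ)))
  ; unique   = Unique-++⁺ (Unique-map⁺ inj₁-injective (unique LI)) (Unique-map⁺ inj₂-injective (unique LJ)) disjoint
  ; complete = λ { (inj₁ a) → ∈-++⁺ˡ (∈-map⁺ inj₁ (complete LI a))
                 ; (inj₂ b) → ∈-++⁺ʳ _ (∈-map⁺ inj₂ (complete LJ b)) }
  }
  where
  disjoint : ∀ {w} → ¬ (w ∈ map inj₁ (elems LI) × w ∈ map inj₂ (elems LJ))
  disjoint (w∈₁ , w∈₂) with ∈-map⁻ inj₁ w∈₁ | ∈-map⁻ inj₂ w∈₂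
  ... | _ , _ , refl | _ , _ , ()

module _ (G : Graph) where

  Edges : EdgeList G → Set
  Edges M = All (λ e → Adj G (proj₁ e) (proj₂ e)) M

  Independent : List (V G) → Set
  Independent S = ∀ {s t} → s ∈ S → t ∈ S → ¬ Adj G s t

  Endpoint : V G → V G × V G → Set
  Endpoint z e = z ≡ proj₁ e ⊎ z ≡ proj₂ e

  ends-length : ∀ (M : EdgeList G) → length (ends {G} M) ≡ length M + length M
  ends-length []      = refl
  ends-length (_ ∷ M) = cong suc (trans (cong suc (ends-length M)) (sym (+-suc (length M) (length M))))

  ends-++ : ∀ (M₁ M₂ : EdgeList G) → ends {G} (M₁ ++ M₂) ≡ ends {G} M₁ ++ ends {G} M₂
  ends-++ []             M₂ = refl
  ends-++ ((a , b) ∷ M₁) M₂ = cong (λ rest → a ∷ b ∷ rest) (ends-++ M₁ M₂)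

  ∈-ends-++ˡ : ∀ {z} (M₁ M₂ : EdgeList G) → z ∈ ends {G} M₁ → z ∈ ends {G} (M₁ ++ M₂)
  ∈-ends-++ˡ M₁ M₂ z∈ = subst (_ ∈_) (sym (ends-++ M₁ M₂)) (∈-++⁺ˡ z∈)

  ∈-ends-++ʳ : ∀ {z} (M₁ M₂ : EdgeList G) → z ∈ ends {G} M₂ → z ∈ ends {G} (M₁ ++ M₂)
  ∈-ends-++ʳ M₁ M₂ z∈ = subst (_ ∈_) (sym (ends-++ M₁ M₂)) (∈-++⁺ʳ (ends {G} M₁) z∈)

  ends-edge : ∀ {z} (M : EdgeList G) → z ∈ ends {G} M → ∃[ e ] (e ∈ M × Endpoint z e)
  ends-edge (_ ∷ M) (here z≡a)         = _ , here refl , inj₁ z≡a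
  ends-edge (_ ∷ M) (there (here z≡b)) = _ , here refl , inj₂ z≡b
  ends-edge (_ ∷ M) (there (there z∈)) with ends-edge M z∈
  ... | e , e∈M , z-end = e , there e∈M , z-end

  ends-─ : ∀ {z e} {M : EdgeList G} (p : e ∈ M) → z ∈ ends {G} M →
           Endpoint z e ⊎ z ∈ ends {G} (M ─ p)
  ends-─ (here refl) (here z≡a)         = inj₁ (inj₁ z≡a)
  ends-─ (here refl) (there (here z≡b)) = inj₁ (inj₂ z≡b)
  ends-─ (here refl) (there (there z∈)) = inj₂ z∈
  ends-─ (there p)   (here z≡a)         = inj₂ (here z≡a)
  ends-─ (there p)   (there (here z≡b)) = inj₂ (there (here z≡b))
  ends-─ (there p)   (there (there z∈)) = Sum.map₂ (there ∘ there) (ends-─ p z∈)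

  endpoints-adjacent : ∀ {s t e} → Adj G (proj₁ e) (proj₂ e) → Endpoint s e → Endpoint t e →
                       s ≢ t → ¬ Adj G s t → ¬ Adj G t s → ⊥
  endpoints-adjacent _   (inj₁ refl) (inj₁ refl) s≢t _   _   = s≢t refl
  endpoints-adjacent adj (inj₁ refl) (inj₂ refl) _   ¬st _   = ¬st adj
  endpoints-adjacent adj (inj₂ refl) (inj₁ refl) _   _   ¬ts = ¬ts adj
  endpoints-adjacent _   (inj₂ refl) (inj₂ refl) s≢t _   _   = s≢t refl

  -- Each edge covers at most one vertex of an independent set, so an
  -- independent set covered by a list of edges is no larger than it.
  independent-bound : ∀ {S} (M : EdgeList G) → Unique S → Independent S → Edges M →
                      S ⊆ ends {G} M → length S ≤ length M
  independent-bound {[]}    _ _ _ _ _ = z≤n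
  independent-bound {s ∷ S} M (s∉S ∷ uniq) indep edges S⊆ with ends-edge M (S⊆ (here refl))
  ... | e , e∈M , s-end =
    ≤-trans (s≤s (independent-bound (M ─ e∈M) uniq (λ p q → indep (there p) (there q)) (─⁺ e∈M edges) S⊆M─e))
            (≤-reflexive (sym (length-removeAt′ M (index e∈M))))
    where
    S⊆M─e : S ⊆ ends {G} (M ─ e∈M)
    S⊆M─e t∈S with ends-─ e∈M (S⊆ (there t∈S))
    ... | inj₂ t∈ = t∈
    ... | inj₁ t-end = ⊥-elim (endpoints-adjacent (All.lookup edges e∈M) s-end t-end (All.lookup s∉S t∈S)
                                 (indep (here refl) (there t∈S)) (indep (there t∈S) (here refl)))

  family-bound : ∀ {I k} (L : Listing I k) (h : I → V G) → (∀ {a b} → h a ≡ h b → a ≡ b) →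
                 (∀ a b → ¬ Adj G (h a) (h b)) → ∀ {M} → Edges M → (∀ a → h a ∈ ends {G} M) →
                 k ≤ length M
  family-bound L h h-injective h-independent {M} edges covered =
    subst (_≤ length M) (trans (length-map h (elems L)) (length≡ L))
      (independent-bound M (Unique-map⁺ h-injective (unique L)) independent edges covered′)
    where
    independent : Independent (map h (elems L))
    independent s∈ t∈ with ∈-map⁻ h s∈ | ∈-map⁻ h t∈
    ... | a , _ , refl | b , _ , refl = h-independent a b
    covered′ : map h (elems L) ⊆ ends {G} M
    covered′ s∈ with ∈-map⁻ h s∈
    ... | a , _ , refl = covered a

  matching-bound : ∀ {k} → Listing (V G) k → ∀ {M} → IsMatching G M → length M + length M ≤ k
  matching-bound L {M} (_ , uniq) =
    subst₂ _≤_ (ends-length M) (length≡ L) (unique-length uniq (λ {z} _ → complete L z))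

  pairUp : ∀ {k} → (Fin k → V G) → (Fin k → V G) → EdgeList G
  pairUp {k} f g = map (λ i → f i , g i) (allFin k)

  pairUp-edges : ∀ {k} (f g : Fin k → V G) → (∀ i → Adj G (f i) (g i)) → Edges (pairUp f g)
  pairUp-edges f g adj = All-map⁺ (All.tabulate (λ {i} _ → adj i))

  pairUp-length : ∀ {k} (f g : Fin k → V G) → length (pairUp f g) ≡ k
  pairUp-length {k} f g = trans (length-map _ (allFin k)) (length-tabulate (λ i → i))

  pairUp-covers : ∀ {k} (f g : Fin k → V G) i → f i ∈ ends {G} (pairUp f g) × g i ∈ ends {G} (pairUp f g)
  pairUp-covers {k} f g i = go (allFin k) (∈-allFin i)
    where
    go : ∀ is → i ∈ is → f i ∈ ends {G} (map (λ i → f i , g i) is) × g i ∈ ends {G} (map (λ i → f i , g i) is)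
    go (_ ∷ is) (here refl) = here refl , there (here refl)
    go (_ ∷ is) (there i∈) = Product.map (there ∘ there) (there ∘ there) (go is i∈)

  module _ (_≟V_ : DecidableEquality (V G)) where
    open DecMembership _≟V_ using (_∈?_)

    near-perfect : ∀ {k} → Listing (V G) (suc (k + k)) → ∀ {M w} → Edges M → length M ≡ k →
                   (∀ z → z ≢ w → z ∈ ends {G} M) → IsMatching G M × w ∉ ends {G} M
    near-perfect L {M} {w} edges refl covers
      with unique-by-length (unique L) E⊆ (λ {z} _ → complete L z)
             (≤-reflexive (trans (cong suc (ends-length M)) (sym (length≡ L))))
      where
      E⊆ : elems L ⊆ w ∷ ends {G} M
      E⊆ {z} _ with z ≟V w
      ... | yes z≡w = here z≡w
      ... | no  z≢w = there (covers z z≢w)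
    ... | w∉ ∷ uniq = (edges , uniq) , λ w∈ → All.lookup w∉ w∈ refl

    -- In a maximal matching, of two families joined completely to each
    -- other, one is entirely covered (else a free edge could be added).
    maximal-covers : ∀ {k l M} → IsMaximal G M → (f : Fin k → V G) (g : Fin l → V G) →
                     (∀ a b → Adj G (f a) (g b)) →
                     (∀ a → f a ∈ ends {G} M) ⊎ (∀ b → g b ∈ ends {G} M)
    maximal-covers {k} {l} {M} (_ , no-free-edge) f g complete-join
      with all? (λ a → f a ∈? ends {G} M) | all? (λ b → g b ∈? ends {G} M)
    ... | yes f-covered | _            = inj₁ f-covered
    ... | no  _         | yes g-covered = inj₂ g-covered
    ... | no  ¬f-covered | no ¬g-covered
      with a , fa∉ ← ¬∀⟶∃¬ k _ (λ a → f a ∈? ends {G} M) ¬f-covered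
         | b , gb∉ ← ¬∀⟶∃¬ l _ (λ b → g b ∈? ends {G} M) ¬g-covered
      = ⊥-elim (no-free-edge (f a) (g b) (complete-join a b) fa∉ gb∉)

pattern A k = inj₁ (inj₁ k)
pattern B k = inj₁ (inj₂ k)
pattern X k = inj₂ (inj₁ k)
pattern Z k = inj₂ (inj₂ k)

_≟GV_ : ∀ {n m} → DecidableEquality (GV n m)
_≟GV_ = ≡-dec (≡-dec _≟_ _≟_) (≡-dec _≟_ _≟_)

GV-listing : ∀ n m → Listing (GV n m) (suc ((n + m) + (n + m)))
GV-listing n m = subst (Listing (GV n m)) (vertex-count n m)
  (⊎-listing (⊎-listing (finListing n) (finListing n)) (⊎-listing (finListing (suc m)) (finListing m)))
  where
  vertex-count : ∀ n m → (n + n) + (suc m + m) ≡ suc ((n + m) + (n + m))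
  vertex-count = solve-∀

side : ∀ {n} → Bool → Fin n → KV n n
side false = inj₁
side true  = inj₂

side-injective : ∀ {n} b {k l : Fin n} → side b k ≡ side b l → k ≡ l
side-injective false refl = refl
side-injective true  refl = refl

side-independent : ∀ {n} b {k l : Fin n} → ¬ KAdj (side b k) (side b l)
side-independent false ()
side-independent true  ()

-- The attachment vertices u, v of an edge of K_{n,n} lie on opposite
-- sides, so each side contains exactly one of them, its hub c.
side-hub : ∀ {n} {u v : KV n n} → KAdj u v → ∀ b → ∃[ c ] ∀ {k} → side b k ≡ u ⊎ side b k ≡ v → k ≡ c
side-hub (lr i j) false = i , λ { (inj₁ refl) → refl ; (inj₂ ()) }
side-hub (lr i j) true  = j , λ { (inj₁ ()) ; (inj₂ refl) → refl }
side-hub (rl i j) false = i , λ { (inj₁ ()) ; (inj₂ refl) → refl }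
side-hub (rl i j) true  = j , λ { (inj₁ refl) → refl ; (inj₂ ()) }

module GraphG (n' m' : ℕ) (u v : KV (suc n') (suc n')) (x y : Fin (suc (suc m'))) where
  n m : ℕ
  n = suc n'
  m = suc m'

  G : Graph
  G = Gmn n m u v x y

  crossing : ∀ {a k} → GAdj n m u v x y (inj₁ a) (X k) → a ≡ u ⊎ a ≡ v
  crossing ux = inj₁ refl
  crossing vy = inj₂ refl

  crossing′ : ∀ {a k} → GAdj n m u v x y (X k) (inj₁ a) → a ≡ u ⊎ a ≡ v
  crossing′ xu = inj₁ refl
  crossing′ yv = inj₂ refl

  -- Since |V G| = 2(n+m)+1, no matching has more than n+m edges.
  matching-size : ∀ {M} → IsMatching G M → length M ≤ n + m
  matching-size matching = half (matching-bound G (GV-listing n m) matching)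

  PerfectWithout : V G → Set
  PerfectWithout w = ∃[ M ] (IsMatching G M × w ∉ ends {G} M × (∀ z → z ≢ w → z ∈ ends {G} M))

  perfect-without : ∀ {w} M → Edges G M → length M ≡ n + m → (∀ z → z ≢ w → z ∈ ends {G} M) →
                    PerfectWithout w
  perfect-without M edges len covers with near-perfect G _≟GV_ (GV-listing n m) edges len covers
  ... | matching , w∉ = M , matching , w∉ , covers

  K-block : Fin n → Fin n → EdgeList G
  K-block p q = pairUp G (A ∘ punchIn p) (B ∘ punchIn q)

  XZ-block : Fin (suc m) → EdgeList G
  XZ-block r = pairUp G (X ∘ punchIn r) Z

  blocks : Fin n → Fin n → Fin (suc m) → EdgeList G
  blocks p q r = K-block p q ++ XZ-block r

  blocks-edges : ∀ p q r → Edges G (blocks p q r)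
  blocks-edges p q r = All-++⁺ (pairUp-edges G (A ∘ punchIn p) (B ∘ punchIn q) (λ _ → left (lr _ _)))
                                (pairUp-edges G (X ∘ punchIn r) Z (λ _ → right (lr _ _)))

  blocks-length : ∀ p q r → length (blocks p q r) ≡ n' + m
  blocks-length p q r = trans (length-++ (K-block p q))
    (cong₂ _+_ (pairUp-length G (A ∘ punchIn p) (B ∘ punchIn q)) (pairUp-length G (X ∘ punchIn r) Z))

  blocks-A : ∀ p q r i → A (punchIn p i) ∈ ends {G} (blocks p q r)
  blocks-A p q r i = ∈-ends-++ˡ G (K-block p q) (XZ-block r) (proj₁ (pairUp-covers G (A ∘ punchIn p) (B ∘ punchIn q) i))

  blocks-B : ∀ p q r i → B (punchIn q i) ∈ ends {G} (blocks p q r)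
  blocks-B p q r i = ∈-ends-++ˡ G (K-block p q) (XZ-block r) (proj₂ (pairUp-covers G (A ∘ punchIn p) (B ∘ punchIn q) i))

  blocks-X : ∀ p q r i → X (punchIn r i) ∈ ends {G} (blocks p q r)
  blocks-X p q r i = ∈-ends-++ʳ G (K-block p q) (XZ-block r) (proj₁ (pairUp-covers G (X ∘ punchIn r) Z i))

  blocks-Z : ∀ p q r k → Z k ∈ ends {G} (blocks p q r)
  blocks-Z p q r k = ∈-ends-++ʳ G (K-block p q) (XZ-block r) (proj₂ (pairUp-covers G (X ∘ punchIn r) Z k))

  without-X : ∀ r → PerfectWithout (X r)
  without-X r = perfect-without M edges len covers
    where
    M = pairUp G A B ++ XZ-block r
    edges : Edges G M
    edges = All-++⁺ (pairUp-edges G A B (λ i → left (lr i i))) (pairUp-edges G (X ∘ punchIn r) Z (λ _ → right (lr _ _)))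
    len : length M ≡ n + m
    len = trans (length-++ (pairUp G A B)) (cong₂ _+_ (pairUp-length G A B) (pairUp-length G (X ∘ punchIn r) Z))
    covers : ∀ z → z ≢ X r → z ∈ ends {G} M
    covers (A k) _   = ∈-ends-++ˡ G (pairUp G A B) (XZ-block r) (proj₁ (pairUp-covers G A B k))
    covers (B k) _   = ∈-ends-++ˡ G (pairUp G A B) (XZ-block r) (proj₂ (pairUp-covers G A B k))
    covers (X k) k≢r = all-but {P = λ t → X t ∈ ends {G} M} r
      (λ i → ∈-ends-++ʳ G (pairUp G A B) (XZ-block r) (proj₁ (pairUp-covers G (X ∘ punchIn r) Z i))) k (k≢r ∘ cong X)
    covers (Z k) _   = ∈-ends-++ʳ G (pairUp G A B) (XZ-block r) (proj₂ (pairUp-covers G (X ∘ punchIn r) Z k))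

  without-A : ∀ p q r → GAdj n m u v x y (B q) (X r) → PerfectWithout (A p)
  without-A p q r adj = perfect-without M (adj ∷ blocks-edges p q r) (cong suc (blocks-length p q r)) covers
    where
    M = (B q , X r) ∷ blocks p q r
    covers : ∀ z → z ≢ A p → z ∈ ends {G} M
    covers (A k) k≢p = all-but {P = λ t → A t ∈ ends {G} M} p (λ i → there (there (blocks-A p q r i))) k (k≢p ∘ cong A)
    covers (B k) _   = all-by-punchIn {P = λ t → B t ∈ ends {G} M} q (here refl) (λ i → there (there (blocks-B p q r i))) k
    covers (X k) _   = all-by-punchIn {P = λ t → X t ∈ ends {G} M} r (there (here refl)) (λ i → there (there (blocks-X p q r i))) k
    covers (Z k) _   = there (there (blocks-Z p q r k))

  without-B : ∀ p q r → GAdj n m u v x y (A p) (X r) → PerfectWithout (B q)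
  without-B p q r adj = perfect-without M (adj ∷ blocks-edges p q r) (cong suc (blocks-length p q r)) covers
    where
    M = (A p , X r) ∷ blocks p q r
    covers : ∀ z → z ≢ B q → z ∈ ends {G} M
    covers (A k) _   = all-by-punchIn {P = λ t → A t ∈ ends {G} M} p (here refl) (λ i → there (there (blocks-A p q r i))) k
    covers (B k) k≢q = all-but {P = λ t → B t ∈ ends {G} M} q (λ i → there (there (blocks-B p q r i))) k (k≢q ∘ cong B)
    covers (X k) _   = all-by-punchIn {P = λ t → X t ∈ ends {G} M} r (there (here refl)) (λ i → there (there (blocks-X p q r i))) k
    covers (Z k) _   = there (there (blocks-Z p q r k))

  -- G − Z c, given edges A p — X r and B q — X s with r ≢ s: these two
  -- edges, K-block p q, and a perfect matching of K_{m+1,m} − X r − X s − Z c.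
  without-Z : ∀ c p q r s → r ≢ s → GAdj n m u v x y (A p) (X r) → GAdj n m u v x y (B q) (X s) →
              PerfectWithout (Z c)
  without-Z c p q r s r≢s adj₁ adj₂ = perfect-without M edges len covers
    where
    X′ : Fin m' → V G
    X′ = X ∘ punchIn r ∘ punchIn (punchOut r≢s)
    M₀ = K-block p q ++ pairUp G X′ (Z ∘ punchIn c)
    M = (A p , X r) ∷ (B q , X s) ∷ M₀
    edges : Edges G M
    edges = adj₁ ∷ adj₂ ∷ All-++⁺ (pairUp-edges G (A ∘ punchIn p) (B ∘ punchIn q) (λ _ → left (lr _ _)))
                                   (pairUp-edges G X′ (Z ∘ punchIn c) (λ _ → right (lr _ _)))
    len : length M ≡ n + m
    len = cong suc (trans (cong suc (trans (length-++ (K-block p q))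
            (cong₂ _+_ (pairUp-length G (A ∘ punchIn p) (B ∘ punchIn q)) (pairUp-length G X′ (Z ∘ punchIn c)))))
            (sym (+-suc n' m')))
    in-M₀ : ∀ {z} → z ∈ ends {G} M₀ → z ∈ ends {G} M
    in-M₀ = there ∘ there ∘ there ∘ there
    K-covers = pairUp-covers G (A ∘ punchIn p) (B ∘ punchIn q)
    XZ-covers = pairUp-covers G X′ (Z ∘ punchIn c)
    X-punch-covered : ∀ i → X (punchIn r i) ∈ ends {G} M
    X-punch-covered = all-by-punchIn {P = λ i → X (punchIn r i) ∈ ends {G} M} (punchOut r≢s)
      (subst (λ t → X t ∈ ends {G} M) (sym (punchIn-punchOut r≢s)) (there (there (there (here refl)))))
      (λ i → in-M₀ (∈-ends-++ʳ G (K-block p q) _ (proj₁ (XZ-covers i))))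
    covers : ∀ z → z ≢ Z c → z ∈ ends {G} M
    covers (A k) _   = all-by-punchIn {P = λ t → A t ∈ ends {G} M} p (here refl)
      (λ i → in-M₀ (∈-ends-++ˡ G (K-block p q) _ (proj₁ (K-covers i)))) k
    covers (B k) _   = all-by-punchIn {P = λ t → B t ∈ ends {G} M} q (there (there (here refl)))
      (λ i → in-M₀ (∈-ends-++ˡ G (K-block p q) _ (proj₂ (K-covers i)))) k
    covers (X k) _   = all-by-punchIn {P = λ t → X t ∈ ends {G} M} r (there (here refl)) X-punch-covered k
    covers (Z k) k≢c = all-but {P = λ t → Z t ∈ ends {G} M} c
      (λ i → in-M₀ (∈-ends-++ʳ G (K-block p q) _ (proj₂ (XZ-covers i)))) k (k≢c ∘ cong Z)

  factor-critical : KAdj u v → x ≢ y → FactorCritical G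
  factor-critical _        _   (X r) = without-X r
  factor-critical (lr i j) _   (A p) = without-A p j y vy
  factor-critical (lr i j) _   (B q) = without-B i q x ux
  factor-critical (lr i j) x≢y (Z c) = without-Z c i j x y x≢y ux vy
  factor-critical (rl i j) _   (A p) = without-A p j x ux
  factor-critical (rl i j) _   (B q) = without-B i q y vy
  factor-critical (rl i j) x≢y (Z c) = without-Z c i j y x (x≢y ∘ sym) vy ux

  -- Two independent families of n+m vertices, one of which a maximal
  -- matching must cover: a side of K_{n,n} without its hub c together
  -- with X, or a side of K_{n,n} together with Z.
  with-X : Bool → Fin n → Fin n' ⊎ Fin (suc m) → V G
  with-X b c = Sum.[ inj₁ ∘ side b ∘ punchIn c , X ]

  with-Z : Bool → Fin n ⊎ Fin m → V G
  with-Z b = Sum.[ inj₁ ∘ side b , Z ]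

  with-X-injective : ∀ b c {s t} → with-X b c s ≡ with-X b c t → s ≡ t
  with-X-injective b c {inj₁ k} {inj₁ l} eq = cong inj₁ (punchIn-injective c k l (side-injective b (inj₁-injective eq)))
  with-X-injective b c {inj₂ k} {inj₂ l} refl = refl

  with-Z-injective : ∀ b {s t} → with-Z b s ≡ with-Z b t → s ≡ t
  with-Z-injective b {inj₁ k} {inj₁ l} eq = cong inj₁ (side-injective b (inj₁-injective eq))
  with-Z-injective b {inj₂ k} {inj₂ l} refl = refl

  -- ... and independent: apart from its hub, a side has no edge to X.
  with-X-independent : ∀ b c → (∀ {k} → side b k ≡ u ⊎ side b k ≡ v → k ≡ c) →
                       ∀ s t → ¬ GAdj n m u v x y (with-X b c s) (with-X b c t)
  with-X-independent b c hub (inj₁ k) (inj₁ l) (left adj) = side-independent b adj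
  with-X-independent b c hub (inj₁ k) (inj₂ l) adj        = punchInᵢ≢i c k (hub (crossing adj))
  with-X-independent b c hub (inj₂ k) (inj₁ l) adj        = punchInᵢ≢i c l (hub (crossing′ adj))
  with-X-independent b c hub (inj₂ k) (inj₂ l) (right ())

  with-Z-independent : ∀ b s t → ¬ GAdj n m u v x y (with-Z b s) (with-Z b t)
  with-Z-independent b (inj₁ k) (inj₁ l) (left adj) = side-independent b adj
  with-Z-independent b (inj₁ k) (inj₂ l) ()
  with-Z-independent b (inj₂ k) (inj₁ l) ()
  with-Z-independent b (inj₂ k) (inj₂ l) (right ())

  covered-side : ∀ {M} → IsMaximal G M → ∃[ b ] ∀ k → inj₁ (side b k) ∈ ends {G} M
  covered-side maximal with maximal-covers G _≟GV_ maximal A B (λ k l → left (lr k l))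
  ... | inj₁ A-covered = false , A-covered
  ... | inj₂ B-covered = true  , B-covered

  -- A maximal matching also covers all of X or all of Z, hence one of the
  -- two families above, so it has at least n+m edges.
  maximal-size : KAdj u v → ∀ {M} → IsMaximal G M → n + m ≤ length M
  maximal-size uv {M} maximal@((edges , _) , _)
    with b , side-covered ← covered-side maximal
       | maximal-covers G _≟GV_ maximal X Z (λ k l → right (lr k l))
  ... | inj₁ X-covered with c , hub ← side-hub uv b =
    subst (_≤ length M) (+-suc n' m)
      (family-bound G (⊎-listing (finListing n') (finListing (suc m))) (with-X b c) (with-X-injective b c)
         (with-X-independent b c hub) edges (Sum.[ side-covered ∘ punchIn c , X-covered ]))
  ... | inj₂ Z-covered =
    family-bound G (⊎-listing (finListing n) (finListing m)) (with-Z b) (with-Z-injective b)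
      (with-Z-independent b) edges (Sum.[ side-covered , Z-covered ])

  equimatchable : KAdj u v → Equimatchable G
  equimatchable uv M maximal = proj₁ maximal , λ M′ matching′ → ≤-trans (matching-size matching′) (maximal-size uv maximal)

lemma8 : (m n : ℕ) → 1 ≤ m → 1 ≤ n →
    (u v : KV n n) → KAdj u v →
    (x y : Fin (suc m)) → x ≢ y →
    FactorCritical (Gmn n m u v x y) × Equimatchable (Gmn n m u v x y)
lemma8 (suc m') (suc n') _ _ u v uv x y x≢y = factor-critical uv x≢y , equimatchable uv
  where open GraphG n' m' u v x y
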